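{- Let $m\geq 2$, let $V$ be a finite set with $|V|\geq m+1$, let $\mathcal{A}$ be a matroid on $K(V)$, and let $v_0\in V$. Let $\mathcal{H}_m^{(1)}=\{K(\{v\}\cup A)\cup K(V\setminus\{v\}) : v\in V,\ A\subseteq V\setminus\{v\},\ |A|=m-1\}$. (1) If every set in $\mathcal{H}_m^{(1)}$ is closed in $\mathcal{A}$, then $K(V\setminus\{v_0\})$ is closed in $\mathcal{A}$. (2) If every set in $\mathcal{H}_m^{(1)}$ is a hyperplane of $\mathcal{A}$, then the rank of $K(V\setminus\{v_0\})$ in $\mathcal{A}$ equals $r(K(V))-m$, where $r$ is the rank function of $\mathcal{A}$.
   Context: For a finite set $W$, $K(W)=\{uv : u,v\in W, u\neq v\}$ is the edge set of the complete graph on $W$. A hyperplane of a matroid is a maximal subset of the ground set containing no basis; a set is closed if it equals its closure. -}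

module Defs where

open import Data.Nat using (ℕ; _≤_; _<_; _+_; _∸_)
open import Data.Bool using (Bool; true; false; _∧_; _∨_)
open import Data.Fin using (Fin; _<?_) renaming (_<_ to _<ᶠ_)
import Data.Fin as F
open import Data.Fin.Subset using (Subset)
open import Data.Vec using (lookup)
open import Data.List using (List; []; _∷_; concatMap; length; filterᵇ)
open import Data.List using () renaming (allFin to allFinL)
open import Data.Product using (Σ; ∃; _×_; _,_)
open import Relation.Nullary using (¬_; yes; no)
open import Relation.Nullary.Decidable using (⌊_⌋)
open import Relation.Binary.PropositionalEquality using (_≡_)

-- Vertex set V = Fin n.  An edge uv of K(V) (u ≠ v) is represented
-- uniquely as an ordered pair (u , v) with u < v.
Edge : ℕ → Set
Edge n = Σ (Fin n) λ u → Σ (Fin n) λ v → u <ᶠ v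

allEdges : (n : ℕ) → List (Edge n)
allEdges n = concatMap (λ u → concatMap (λ v → pick u v) (allFinL n)) (allFinL n)
  where
  pick : Fin n → Fin n → List (Edge n)
  pick u v with u <? v
  ... | yes p = (u , v , p) ∷ []
  ... | no _  = []

ESet : ℕ → Set
ESet n = Edge n → Bool

card : ∀ {n} → ESet n → ℕ
card {n} X = length (filterᵇ X (allEdges n))

_⊆E_ : ∀ {n} → ESet n → ESet n → Set
X ⊆E Y = ∀ e → X e ≡ true → Y e ≡ true

∅E : ∀ {n} → ESet n
∅E _ = false

sameEdge : ∀ {n} → Edge n → Edge n → Bool
sameEdge (u , v , _) (u' , v' , _) = ⌊ u F.≟ u' ⌋ ∧ ⌊ v F.≟ v' ⌋

insert : ∀ {n} → Edge n → ESet n → ESet n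
insert e X e' = X e' ∨ sameEdge e e'

K : ∀ {n} → Subset n → ESet n
K W (u , v , _) = lookup W u ∧ lookup W v

record Matroid (n : ℕ) : Set₁ where
  field
    Indep     : ESet n → Set
    indep-∅   : Indep ∅E
    indep-⊆   : ∀ {I J} → J ⊆E I → Indep I → Indep J
    indep-aug : ∀ {I J} → Indep I → Indep J → card I < card J →
                ∃ λ e → J e ≡ true × I e ≡ false × Indep (insert e I)

module _ {n : ℕ} (M : Matroid n) where
  open Matroid M

  IsBasis : ESet n → Set
  IsBasis B = Indep B × (∀ J → Indep J → B ⊆E J → J ⊆E B)

  ContainsBasis : ESet n → Set
  ContainsBasis X = ∃ λ B → IsBasis B × B ⊆E X

  IsHyperplane : ESet n → Set
  IsHyperplane X = ¬ ContainsBasis X × (∀ Y → X ⊆E Y → ¬ ContainsBasis Y → Y ⊆E X)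

  HasRank : ESet n → ℕ → Set
  HasRank X k = (∃ λ I → Indep I × I ⊆E X × card I ≡ k)
              × (∀ I → Indep I → I ⊆E X → card I ≤ k)

  InClosure : ESet n → Edge n → Set
  InClosure X e = ∃ λ k → HasRank X k × HasRank (insert e X) k

  Closed : ESet n → Set
  Closed X = ∀ e → (X e ≡ true → InClosure X e) × (InClosure X e → X e ≡ true)

-- Write d = m - 1, N = V - v0, F = K(N) and H(A) = K({v0} ∪ A) ∪ F for A ⊆ N,
-- so that H(A) is the member of the family at v0.  Assume every H(A) with |A| = d
-- is closed (hyperplanes are).  For c ∉ C ⊆ N with |C| ≤ d, the set H(C) lies in
-- some H(A) with |A| = d and c ∉ A; since closure is monotone, H(C) does not span
-- the edge v0c, so adding it raises the rank.  Adding the vertices of A one at a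
-- time gives r(H(A)) ≥ r(F) + d, and as H(A) ∖ F consists of d edges,
-- r(H(A)) = r(F) + d.  For (1), an edge v0w spanned by F would be spanned by an
-- H(A) avoiding w; the rank of F needed for the other inclusion is read off a
-- maximum independent subset of some H(A).  For (2), a hyperplane has rank
-- r(K(V)) - 1, hence r(F) = r(K(V)) - 1 - d = r(K(V)) - m.

module Submission where

open import Defs
open import Level using (0ℓ)
open import Data.Nat using (ℕ; zero; suc; _+_; _∸_; _≤_; _<_; z≤n; s≤s; z<s)
open import Data.Nat.Properties
open import Data.Bool using (Bool; true; false; _∧_; _∨_)
open import Data.Bool.Properties using (∨-zeroʳ; ∧-comm; ∧-zeroʳ; ∧-conicalˡ; ∧-conicalʳ)
open import Data.Empty using (⊥-elim; ⊥-elim-irr)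
open import Data.Fin using (Fin; zero; suc) renaming (_<_ to _<ᶠ_; _<?_ to _<?ᶠ_)
import Data.Fin as F
import Data.Fin.Properties as FP
open import Data.Fin.Subset
  using (Subset; inside; outside; ⁅_⁆; ∁; _∪_; _-_; _∈_; _∉_; _⊆_; ∣_∣; ⊤; Nonempty)
open import Data.Fin.Subset.Properties
  using ( _∈?_; nonempty?; Empty-unique; ⊥⊆; ∣⊥∣≡0; ∣⁅x⁆∣≡1; ∣∁p∣≡n∸∣p∣; p⊆q⇒∣p∣≤∣q∣
        ; x∈⁅x⁆; x∈⁅y⁆⇒x≡y; x≢y⇒x∉⁅y⁆; x∈p⇒x∉∁p; x∉p⇒x∈∁p; p⊆p∪q; q⊆p∪q; x∈p∪q⁻; x∈p∪q⁺
        ; p─⊥≡p; p─q⊆p; x∈p∧x≢y⇒x∈p-y; drop-∷-⊆; in⊆in; out⊆ )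
open import Data.Vec using ([]; _∷_; lookup; here; there)
open import Data.Vec.Properties using ([]=⇒lookup; lookup⇒[]=; lookup-replicate)
open import Data.List using (List; []; _∷_; _++_; length; filterᵇ; concatMap)
open import Data.List using () renaming (allFin to allFinL)
open import Data.List.Properties using (filter-++; length-++; length-filter)
open import Data.List.Membership.Propositional using () renaming (_∈_ to _∈ˡ_)
open import Data.List.Membership.Propositional.Properties using (∈-concatMap⁺; ∈-allFin)
open import Data.List.Relation.Unary.Any as Any using (here; there)
open import Data.List.Relation.Unary.All as All using (All; []; _∷_)
open import Data.List.Relation.Unary.AllPairs using (_∷_)
open import Data.List.Relation.Unary.Unique.Propositional using (Unique)
open import Data.List.Relation.Unary.Unique.Propositional.Properties using (allFin⁺)
open import Data.Product using (Σ; ∃; _×_; _,_; proj₁; proj₂)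
open import Data.Sum as Sum using (_⊎_; inj₁; inj₂)
open import Effect.Monad using (RawMonad)
open import Function using (_∘_; id)
open import Relation.Binary using (tri<; tri≈; tri>)
open import Relation.Nullary using (¬_; yes; no; contradiction)
open import Relation.Nullary.Decidable using (decidable-stable; ¬¬-excluded-middle)
open import Relation.Nullary.Negation using (¬¬-Monad)
open import Relation.Binary.PropositionalEquality

count : {A : Set} → (A → Bool) → List A → ℕ
count p xs = length (filterᵇ p xs)

module _ {A : Set} where

  count-++ : (p : A → Bool) (xs ys : List A) → count p (xs ++ ys) ≡ count p xs + count p ys
  count-++ p xs ys = trans (cong length (filter-++ _ xs ys)) (length-++ (filterᵇ p xs))

  count-mono : {p q : A → Bool} → (∀ x → p x ≡ true → q x ≡ true) →
               ∀ xs → count p xs ≤ count q xs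
  count-mono h [] = z≤n
  count-mono {p} {q} h (x ∷ xs) with p x in px | q x in qx
  ... | true  | true  = s≤s (count-mono h xs)
  ... | true  | false = contradiction (trans (sym (h x px)) qx) λ ()
  ... | false | true  = m≤n⇒m≤1+n (count-mono h xs)
  ... | false | false = count-mono h xs

  count-mono-< : {p q : A → Bool} → (∀ x → p x ≡ true → q x ≡ true) →
                 ∀ {x} xs → x ∈ˡ xs → q x ≡ true → p x ≡ false → suc (count p xs) ≤ count q xs
  count-mono-< h (x ∷ xs) (here refl) qx px rewrite qx | px = s≤s (count-mono h xs)
  count-mono-< {p} {q} h (y ∷ xs) (there x∈xs) qx px with p y in py | q y in qy
  ... | true  | true  = s≤s (count-mono-< h xs x∈xs qx px)
  ... | true  | false = contradiction (trans (sym (h y py)) qy) λ ()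
  ... | false | true  = m≤n⇒m≤1+n (count-mono-< h xs x∈xs qx px)
  ... | false | false = count-mono-< h xs x∈xs qx px

  count-∨ : (p q : A → Bool) → ∀ xs → count (λ x → p x ∨ q x) xs ≤ count p xs + count q xs
  count-∨ p q [] = z≤n
  count-∨ p q (x ∷ xs) with p x | q x
  ... | true  | true  = s≤s (≤-trans (count-∨ p q xs) (+-monoʳ-≤ (count p xs) (n≤1+n _)))
  ... | true  | false = s≤s (count-∨ p q xs)
  ... | false | true  = ≤-trans (s≤s (count-∨ p q xs)) (≤-reflexive (sym (+-suc _ _)))
  ... | false | false = count-∨ p q xs

  count-concatMap-≡0 : (p : A → Bool) {B : Set} (f : B → List A) {xs : List B} →
                       All (λ y → count p (f y) ≡ 0) xs → count p (concatMap f xs) ≡ 0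
  count-concatMap-≡0 p f [] = refl
  count-concatMap-≡0 p f {y ∷ ys} (fy≡0 ∷ rest) =
    trans (count-++ p (f y) (concatMap f ys)) (cong₂ _+_ fy≡0 (count-concatMap-≡0 p f rest))

  count-concatMap-≤1 : (p : A → Bool) {k : ℕ} (f : Fin k → List A) (b : Fin k) →
                       (∀ y → y ≢ b → count p (f y) ≡ 0) → count p (f b) ≤ 1 →
                       ∀ {xs} → Unique xs → count p (concatMap f xs) ≤ 1
  count-concatMap-≤1 p f b off on {[]} _ = z≤n
  count-concatMap-≤1 p f b off on {y ∷ ys} (y∉ys ∷ unique) with y F.≟ b
  ... | yes refl = begin
    count p (concatMap f (y ∷ ys))       ≡⟨ count-++ p (f y) (concatMap f ys) ⟩
    count p (f y) + count p (concatMap f ys)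
      ≡⟨ cong (count p (f y) +_) (count-concatMap-≡0 p f (All.map (λ y≢z → off _ (y≢z ∘ sym)) y∉ys)) ⟩
    count p (f y) + 0                    ≡⟨ +-identityʳ _ ⟩
    count p (f y)                        ≤⟨ on ⟩
    1                                    ∎
    where open ≤-Reasoning
  ... | no y≢b = ≤-trans (≤-reflexive (trans (count-++ p (f y) (concatMap f ys))
                                              (cong (_+ _) (off y y≢b))))
                         (count-concatMap-≤1 p f b off on unique)

module _ {n : ℕ} where

  edge-≡ : {u u' v v' : Fin n} (p : u <ᶠ v) (p' : u' <ᶠ v') → u ≡ u' → v ≡ v' →
           _≡_ {A = Edge n} (u , v , p) (u' , v' , p')
  edge-≡ p p' refl refl = cong (λ q → _ , _ , q) (FP.<-irrelevant p p')

  sameEdge-refl : (e : Edge n) → sameEdge e e ≡ true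
  sameEdge-refl (u , v , _) with u F.≟ u | v F.≟ v
  ... | yes _  | yes _  = refl
  ... | no u≢u | _      = contradiction refl u≢u
  ... | _      | no v≢v = contradiction refl v≢v

  sameEdge⇒≡ : (e e' : Edge n) → sameEdge e e' ≡ true → e ≡ e'
  sameEdge⇒≡ (u , v , p) (u' , v' , p') same with u F.≟ u' | v F.≟ v' | same
  ... | yes u≡u' | yes v≡v' | _ = edge-≡ p p' u≡u' v≡v'
  ... | yes _    | no _     | ()
  ... | no _     | _        | ()

-- The row function of allEdges is local to its definition, so it is
-- recovered by unification.
allEdges-rows : ∀ n → Σ (Fin n → Fin n → List (Edge n)) λ pick →
                allEdges n ≡ concatMap (λ u → concatMap (pick u) (allFinL n)) (allFinL n)
allEdges-rows n = _ , refl

module _ {n : ℕ} where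

  private
    pick : Fin n → Fin n → List (Edge n)
    pick = proj₁ (allEdges-rows n)

  ∈-pick : {u v : Fin n} (p : u <ᶠ v) → (u , v , p) ∈ˡ pick u v
  ∈-pick {u} {v} p with u <?ᶠ v
  ... | yes p' = here (edge-≡ p p' refl refl)
  ... | no ¬p  = contradiction p ¬p

  count-pick-≤1 : (q : Edge n → Bool) (u v : Fin n) → count q (pick u v) ≤ 1
  count-pick-≤1 q u v with u <?ᶠ v
  ... | no _ = z≤n
  ... | yes p with q (u , v , p)
  ...   | true  = ≤-refl
  ...   | false = z≤n

  count-sameEdge-pick : (e : Edge n) (u' v' : Fin n) → proj₁ e ≢ u' ⊎ proj₁ (proj₂ e) ≢ v' →
                        count (sameEdge e) (pick u' v') ≡ 0
  count-sameEdge-pick (u , v , _) u' v' differ with u' <?ᶠ v'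
  ... | no _ = refl
  ... | yes _ with u F.≟ u' | v F.≟ v' | differ
  ...   | yes u≡u' | yes _    | inj₁ u≢u' = contradiction u≡u' u≢u'
  ...   | yes _    | yes v≡v' | inj₂ v≢v' = contradiction v≡v' v≢v'
  ...   | yes _    | no _     | _         = refl
  ...   | no _     | _        | _         = refl

  ∈-allEdges : (e : Edge n) → e ∈ˡ allEdges n
  ∈-allEdges (u , v , p) =
    ∈-concatMap⁺ (λ u' → concatMap (pick u') (allFinL n))
      (Any.map (λ { refl → ∈-concatMap⁺ (pick u) (Any.map (λ { refl → ∈-pick p }) (∈-allFin v)) })
               (∈-allFin u))

  count-sameEdge-≤1 : (e : Edge n) → count (sameEdge e) (allEdges n) ≤ 1
  count-sameEdge-≤1 e@(u , v , _) =
    count-concatMap-≤1 (sameEdge e) (λ u' → concatMap (pick u') (allFinL n)) u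
      (λ u' u'≢u → count-concatMap-≡0 (sameEdge e) (pick u') {allFinL n}
                     (All.universal (λ v' → count-sameEdge-pick e u' v' (inj₁ (u'≢u ∘ sym))) _))
      (count-concatMap-≤1 (sameEdge e) (pick u) v
        (λ v' v'≢v → count-sameEdge-pick e u v' (inj₂ (v'≢v ∘ sym)))
        (count-pick-≤1 (sameEdge e) u v) (allFin⁺ n))
      (allFin⁺ n)

∨-≡-trueˡ : ∀ {a} b → a ≡ true → a ∨ b ≡ true
∨-≡-trueˡ b refl = refl

∨-≡-trueʳ : ∀ a {b} → b ≡ true → a ∨ b ≡ true
∨-≡-trueʳ a refl = ∨-zeroʳ a

∧-≡-true : ∀ {a b} → a ≡ true → b ≡ true → a ∧ b ≡ true
∧-≡-true refl refl = refl

true⊎false : (b : Bool) → b ≡ true ⊎ b ≡ false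
true⊎false true  = inj₁ refl
true⊎false false = inj₂ refl

true≢false : ∀ {b} → b ≡ true → b ≡ false → ∀ {A : Set} → A
true≢false refl ()

module _ {n : ℕ} where

  _∩E_ : ESet n → ESet n → ESet n
  (X ∩E Y) e = X e ∧ Y e

  ∩E-⊆ˡ : (X Y : ESet n) → (X ∩E Y) ⊆E X
  ∩E-⊆ˡ X Y e = ∧-conicalˡ (X e) (Y e)

  ∩E-⊆ʳ : (X Y : ESet n) → (X ∩E Y) ⊆E Y
  ∩E-⊆ʳ X Y e = ∧-conicalʳ (X e) (Y e)

  card-mono : {X Y : ESet n} → X ⊆E Y → card X ≤ card Y
  card-mono X⊆Y = count-mono X⊆Y (allEdges n)

  card-≤-#edges : (X : ESet n) → card X ≤ length (allEdges n)
  card-≤-#edges X = length-filter _ (allEdges n)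

  ⊆E-insert : (e : Edge n) (X : ESet n) → X ⊆E insert e X
  ⊆E-insert e X e' Xe' = ∨-≡-trueˡ _ Xe'

  insert-∋ : (e : Edge n) (X : ESet n) → insert e X e ≡ true
  insert-∋ e X = ∨-≡-trueʳ (X e) (sameEdge-refl e)

  insert-⊆E : {X Y : ESet n} (e : Edge n) → X ⊆E Y → Y e ≡ true → insert e X ⊆E Y
  insert-⊆E {X} {Y} e X⊆Y Ye e' ins with X e' in Xe'
  ... | true  = X⊆Y e' Xe'
  ... | false = subst (λ f → Y f ≡ true) (sameEdge⇒≡ e e' ins) Ye

  insert-monoE : {X Y : ESet n} (e : Edge n) → X ⊆E Y → insert e X ⊆E insert e Y
  insert-monoE {Y = Y} e X⊆Y = insert-⊆E e (λ e' h → ⊆E-insert e Y e' (X⊆Y e' h)) (insert-∋ e Y)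

  ⊆E-insert-∩E : {X Y : ESet n} (e : Edge n) → X ⊆E insert e Y → X ⊆E insert e (X ∩E Y)
  ⊆E-insert-∩E {X} {Y} e X⊆ e' Xe' with Y e' in Ye'
  ... | true  = ∨-≡-trueˡ _ (∧-≡-true Xe' refl)
  ... | false = ∨-≡-trueʳ _ (subst (λ b → b ∨ sameEdge e e' ≡ true) Ye' (X⊆ e' Xe'))

  ⊆E-false : {X Y : ESet n} {e : Edge n} → X ⊆E Y → Y e ≡ false → X e ≡ false
  ⊆E-false {X} {e = e} X⊆Y Ye with X e in Xe
  ... | true  = true≢false (X⊆Y e Xe) Ye
  ... | false = refl

  insert-∋⇒≡ : {X : ESet n} {x e : Edge n} → insert x X e ≡ true → X e ≡ false → x ≡ e
  insert-∋⇒≡ {x = x} {e} ins Xe = sameEdge⇒≡ x e (subst (λ b → b ∨ sameEdge x e ≡ true) Xe ins)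

  card-insert-∉ : (e : Edge n) (X : ESet n) → X e ≡ false → suc (card X) ≤ card (insert e X)
  card-insert-∉ e X Xe = count-mono-< (⊆E-insert e X) (allEdges n) (∈-allEdges e) (insert-∋ e X) Xe

  card-insert-≤ : (e : Edge n) (X : ESet n) → card (insert e X) ≤ suc (card X)
  card-insert-≤ e X = begin
    card (insert e X)                             ≤⟨ count-∨ X (sameEdge e) (allEdges n) ⟩
    card X + count (sameEdge e) (allEdges n)      ≤⟨ +-monoʳ-≤ (card X) (count-sameEdge-≤1 e) ⟩
    card X + 1                                    ≡⟨ +-comm (card X) 1 ⟩
    suc (card X)                                  ∎
    where open ≤-Reasoning

  card-⊆E-insert : {X Y : ESet n} (e : Edge n) → X ⊆E insert e Y → card X ≤ suc (card Y)
  card-⊆E-insert {Y = Y} e X⊆ = ≤-trans (card-mono X⊆) (card-insert-≤ e Y)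

-- Rank, closure and hyperplanes in a matroid

module Rank {n : ℕ} (M : Matroid n) where
  open Matroid M
  open RawMonad (¬¬-Monad {a = 0ℓ})

  RankAtMost : ESet n → ℕ → Set
  RankAtMost X k = ∀ I → Indep I → I ⊆E X → card I ≤ k

  HasRank-mono : {X Y : ESet n} {a b : ℕ} → X ⊆E Y → HasRank M X a → RankAtMost Y b → a ≤ b
  HasRank-mono X⊆Y ((I , indI , I⊆X , refl) , _) bound = bound I indI (λ e h → X⊆Y e (I⊆X e h))

  HasRank-cong : {X Y : ESet n} {k : ℕ} → X ⊆E Y → Y ⊆E X → HasRank M X k → HasRank M Y k
  HasRank-cong X⊆Y Y⊆X ((I , indI , I⊆X , cardI) , bound) =
    (I , indI , (λ e h → X⊆Y e (I⊆X e h)) , cardI) ,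
    (λ J indJ J⊆Y → bound J indJ (λ e h → Y⊆X e (J⊆Y e h)))

  extend-to-rank : {Y I₀ : ESet n} {q : ℕ} → HasRank M Y q → Indep I₀ → I₀ ⊆E Y →
                   ∃ λ B → Indep B × I₀ ⊆E B × B ⊆E Y × card B ≡ q
  extend-to-rank {Y} {I₀} {q} ((L , indL , L⊆Y , refl) , bound) indI₀ I₀⊆Y =
    grow q I₀ (m≤m+n q (card I₀)) indI₀ I₀⊆Y (λ _ h → h)
    where
    grow : ∀ fuel I → card L ≤ fuel + card I → Indep I → I ⊆E Y → I₀ ⊆E I →
           ∃ λ B → Indep B × I₀ ⊆E B × B ⊆E Y × card B ≡ card L
    grow fuel I _ indI I⊆Y I₀⊆I with card L ≤? card I
    ... | yes L≤I = I , indI , I₀⊆I , I⊆Y , ≤-antisym (bound I indI I⊆Y) L≤I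
    grow zero I room _ _ _ | no L≰I = contradiction room L≰I
    grow (suc fuel) I room indI I⊆Y I₀⊆I | no L≰I with indep-aug indI indL (≰⇒> L≰I)
    ... | e , Le , Ie , indIe =
      grow fuel (insert e I) room' indIe (insert-⊆E e I⊆Y (L⊆Y e Le))
           (λ e' h → ⊆E-insert e I e' (I₀⊆I e' h))
      where
      room' : card L ≤ fuel + card (insert e I)
      room' = ≤-trans room (≤-trans (≤-reflexive (sym (+-suc fuel (card I))))
                                    (+-monoʳ-≤ fuel (card-insert-∉ e I Ie)))

  -- Independence is not decidable, so a rank exists only up to double negation;
  -- the goals where ranks are needed are decidable and recovered by decidable-stable.
  ¬¬-HasRank : (X : ESet n) → ¬ ¬ ∃ (HasRank M X)
  ¬¬-HasRank X = grow (length (allEdges n)) ∅E indep-∅ (λ _ ()) (m≤m+n _ _)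
    where
    Room : ℕ → ESet n → Set
    Room fuel I = length (allEdges n) ≤ fuel + card I

    grow : ∀ fuel I → Indep I → I ⊆E X → Room fuel I → ¬ ¬ ∃ (HasRank M X)
    larger : ∀ fuel I → Room fuel I → ∀ L → Indep L → L ⊆E X → card I < card L →
             ¬ ¬ ∃ (HasRank M X)

    grow fuel I indI I⊆X room =
      ¬¬-excluded-middle {A = ∃ λ L → Indep L × L ⊆E X × card I < card L} >>= λ where
      (yes (L , indL , L⊆X , I<L)) → larger fuel I room L indL L⊆X I<L
      (no ¬larger) → pure (card I , (I , indI , I⊆X , refl) , λ L indL L⊆X →
        decidable-stable (card L ≤? card I) λ L≰I → ¬larger (L , indL , L⊆X , ≰⇒> L≰I))

    larger zero I room L _ _ I<L = contradiction (≤-trans (card-≤-#edges L) room) (<⇒≱ I<L)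
    larger (suc fuel) I room L indL L⊆X I<L =
      grow fuel L indL L⊆X
        (≤-trans room (≤-trans (≤-reflexive (sym (+-suc fuel _))) (+-monoʳ-≤ fuel I<L)))

  maximum⇒IsBasis : {I : ESet n} → Indep I → (∀ J → Indep J → card J ≤ card I) → IsBasis M I
  maximum⇒IsBasis {I} indI maximum = indI , maximal
    where
    maximal : ∀ J → Indep J → I ⊆E J → J ⊆E I
    maximal J indJ I⊆J e Je with I e in Ie
    ... | true  = refl
    ... | false = contradiction (maximum _ (indep-⊆ (insert-⊆E e I⊆J Je) indJ))
                                (<⇒≱ (card-insert-∉ e I Ie))

  basis-card-max : {B L : ESet n} → IsBasis M B → Indep L → card L ≤ card B
  basis-card-max {B} {L} (indB , maximal) indL = decidable-stable (card L ≤? card B) λ L≰B →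
    let (e , _ , Be , indBe) = indep-aug indB indL (≰⇒> L≰B)
    in true≢false (maximal _ indBe (⊆E-insert e B) e (insert-∋ e B)) Be

  basis-of-card : {I B : ESet n} → Indep I → IsBasis M B → card B ≤ card I → IsBasis M I
  basis-of-card indI basisB B≤I =
    maximum⇒IsBasis indI (λ J indJ → ≤-trans (basis-card-max basisB indJ) B≤I)

  rank-insert-of-dependent : {X B : ESet n} (x : Edge n) → Indep B → B ⊆E X → RankAtMost X (card B) →
                             ¬ Indep (insert x B) → HasRank M (insert x X) (card B)
  rank-insert-of-dependent {X} {B} x indB B⊆X bound dep =
    (B , indB , (λ e h → ⊆E-insert x X e (B⊆X e h)) , refl) , bound'
    where
    bound' : RankAtMost (insert x X) (card B)
    bound' L indL L⊆ = decidable-stable (card L ≤? card B) λ L≰B →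
      absurd (indep-aug indB indL (≰⇒> L≰B))
      where
      absurd : ¬ (∃ λ e → L e ≡ true × B e ≡ false × Indep (insert e B))
      absurd (e , Le , Be , indBe) with X e in Xe
      ... | true  = <⇒≱ (card-insert-∉ e B Be) (bound _ indBe (insert-⊆E e B⊆X Xe))
      ... | false =
        dep (subst (λ f → Indep (insert f B)) (sym (insert-∋⇒≡ {X = X} {x} (L⊆ e Le) Xe)) indBe)

  rankAtMost-insert : {X : ESet n} {q : ℕ} → RankAtMost X q → (x : Edge n) →
                      RankAtMost (insert x X) (suc q)
  rankAtMost-insert {X} bound x L indL L⊆ =
    ≤-trans (card-⊆E-insert x (⊆E-insert-∩E x L⊆))
            (s≤s (bound _ (indep-⊆ (∩E-⊆ˡ L X) indL) (∩E-⊆ʳ L X)))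

  InClosure-∈ : {X : ESet n} {e : Edge n} {k : ℕ} → X e ≡ true → HasRank M X k → InClosure M X e
  InClosure-∈ {X} {e} {k} Xe hX = k , hX , HasRank-cong (⊆E-insert e X) (insert-⊆E e (λ _ h → h) Xe) hX

  InClosure-mono : {X Y : ESet n} {x : Edge n} {k : ℕ} → X ⊆E Y → InClosure M X x → HasRank M Y k →
                   InClosure M Y x
  InClosure-mono {Y = Y} {x} X⊆Y _ hY with Y x in Yx
  ... | true = InClosure-∈ Yx hY
  InClosure-mono {x = x} X⊆Y (_ , ((I , indI , I⊆X , refl) , _) , (_ , boundXx)) hY | false
    with extend-to-rank hY indI (λ e h → X⊆Y e (I⊆X e h))
  ... | B , indB , I⊆B , B⊆Y , refl = _ , hY , rank-insert-of-dependent x indB B⊆Y (proj₂ hY) dep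
    where
    dep : ¬ Indep (insert x B)
    dep indBx = <⇒≱ (card-insert-∉ x I (⊆E-false I⊆B (⊆E-false B⊆Y Yx)))
                     (boundXx _ (indep-⊆ (insert-monoE x I⊆B) indBx) (insert-monoE x I⊆X))

  rank-grows : {X Y : ESet n} {x : Edge n} {q r : ℕ} → HasRank M X q → X x ≡ false →
               ¬ InClosure M X x → insert x X ⊆E Y → RankAtMost Y r → suc q ≤ r
  rank-grows {x = x} {r = r} hX@((B , indB , B⊆X , refl) , bound) Xx ¬span ins⊆Y boundY =
    decidable-stable (_ ≤? r) λ ¬grows → ¬¬-excluded-middle λ where
      (yes indBx) → ¬grows (≤-trans (card-insert-∉ x B (⊆E-false B⊆X Xx))
                                    (boundY _ indBx (λ e h → ins⊆Y e (insert-monoE x B⊆X e h))))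
      (no dep) → ¬span (card B , hX , rank-insert-of-dependent x indB B⊆X bound dep)

  -- The half of Closed saying cl(X) ⊆ X; it is all that the argument uses of
  -- closed sets and of hyperplanes.
  Flat : ESet n → Set
  Flat X = ∀ x → X x ≡ false → ¬ InClosure M X x

  Closed⇒Flat : {X : ESet n} → Closed M X → Flat X
  Closed⇒Flat closed x Xx span = true≢false (proj₂ (closed x) span) Xx

  ¬¬-ContainsBasis-insert : {H : ESet n} {x : Edge n} → IsHyperplane M H → H x ≡ false →
                            ¬ ¬ ContainsBasis M (insert x H)
  ¬¬-ContainsBasis-insert {H} {x} (_ , maximal) Hx noBasis =
    true≢false (maximal (insert x H) (⊆E-insert x H) noBasis x (insert-∋ x H)) Hx

  IsHyperplane⇒Flat : {H : ESet n} → IsHyperplane M H → Flat H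
  IsHyperplane⇒Flat hyp x Hx (_ , ((I , indI , I⊆H , refl) , _) , (_ , boundHx)) =
    ¬¬-ContainsBasis-insert hyp Hx λ (B , basisB , B⊆) →
      proj₁ hyp (I , basis-of-card indI basisB (boundHx B (proj₁ basisB) B⊆) , I⊆H)

  hyperplane-rank : {H U : ESet n} {x : Edge n} {k kU : ℕ} → IsHyperplane M H → H x ≡ false →
                    (∀ e → U e ≡ true) → HasRank M U kU → HasRank M H k → suc k ≡ kU
  hyperplane-rank {x = x} hyp Hx total
                  ((IU , indIU , _ , refl) , boundU) ((IH , indIH , IH⊆H , refl) , boundH) =
    ≤-antisym below above
    where
    basisIU : IsBasis M IU
    basisIU = maximum⇒IsBasis indIU (λ J indJ → boundU J indJ (λ e _ → total e))
    below : suc (card IH) ≤ card IU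
    below = decidable-stable (_ ≤? _) λ H≮U →
      proj₁ hyp (IH , basis-of-card indIH basisIU (≤-pred (≰⇒> H≮U)) , IH⊆H)
    above : card IU ≤ suc (card IH)
    above = decidable-stable (_ ≤? _) λ U≰H → ¬¬-ContainsBasis-insert hyp Hx λ (B , basisB , B⊆) →
      U≰H (≤-trans (basis-card-max basisB indIU) (rankAtMost-insert boundH x B (proj₁ basisB) B⊆))

x∉p-x : ∀ {n} {x : Fin n} (p : Subset n) → x ∉ p - x
x∉p-x {x = zero}  (_ ∷ p) ()
x∉p-x {x = suc x} (_ ∷ p) (there x∈p-x) = x∉p-x p x∈p-x

∣p-x∣ : ∀ {n} {x : Fin n} {p : Subset n} → x ∈ p → suc ∣ p - x ∣ ≡ ∣ p ∣
∣p-x∣ {x = zero}  {inside ∷ p}  here        = cong (suc ∘ ∣_∣) (p─⊥≡p p)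
∣p-x∣ {x = suc x} {inside ∷ p}  (there x∈p) = cong suc (∣p-x∣ x∈p)
∣p-x∣ {x = suc x} {outside ∷ p} (there x∈p) = ∣p-x∣ x∈p

module _ {n : ℕ} where

  ∉⇒lookup : {x : Fin n} {p : Subset n} → x ∉ p → lookup p x ≡ false
  ∉⇒lookup {x} {p} x∉p with lookup p x in px
  ... | true  = contradiction (lookup⇒[]= x p px) x∉p
  ... | false = refl

  x∈p-y⇒x≢y : {x y : Fin n} {p : Subset n} → x ∈ p - y → x ≢ y
  x∈p-y⇒x≢y {p = p} x∈p-x refl = x∉p-x p x∈p-x

  p⊆q⇒p-x⊆q-x : {p q : Subset n} {x : Fin n} → p ⊆ q → p - x ⊆ q - x
  p⊆q⇒p-x⊆q-x {p} {x = x} p⊆q y∈p-x = x∈p∧x≢y⇒x∈p-y (p⊆q (p─q⊆p p ⁅ x ⁆ y∈p-x)) (x∈p-y⇒x≢y y∈p-x)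

  x∈p⇒0<∣p∣ : {x : Fin n} {p : Subset n} → x ∈ p → 0 < ∣ p ∣
  x∈p⇒0<∣p∣ {x} {p} x∈p = subst (_≤ ∣ p ∣) (∣⁅x⁆∣≡1 x)
    (p⊆q⇒∣p∣≤∣q∣ λ y∈⁅x⁆ → subst (_∈ p) (sym (x∈⁅y⁆⇒x≡y x y∈⁅x⁆)) x∈p)

  0<∣p∣⇒Nonempty : {p : Subset n} → 0 < ∣ p ∣ → Nonempty p
  0<∣p∣⇒Nonempty {p} 0<∣p∣ with nonempty? p
  ... | yes ne = ne
  ... | no ¬ne = contradiction (trans (cong ∣_∣ (Empty-unique ¬ne)) (∣⊥∣≡0 n)) (>⇒≢ 0<∣p∣)

between : ∀ {n} {P Q : Subset n} (t : ℕ) → P ⊆ Q → ∣ P ∣ ≤ t → t ≤ ∣ Q ∣ →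
          ∃ λ R → P ⊆ R × R ⊆ Q × ∣ R ∣ ≡ t
between {P = []} {[]} t _ _ t≤0 = [] , id , id , sym (n≤0⇒n≡0 t≤0)
between {P = inside ∷ P} {outside ∷ Q} t P⊆Q _ _ with () ← P⊆Q here
between {P = inside ∷ P} {inside ∷ Q} (suc t) P⊆Q (s≤s P≤t) (s≤s t≤Q)
  with between t (drop-∷-⊆ P⊆Q) P≤t t≤Q
... | R , P⊆R , R⊆Q , refl = inside ∷ R , in⊆in P⊆R , in⊆in R⊆Q , refl
between {P = outside ∷ P} {outside ∷ Q} t P⊆Q P≤t t≤Q
  with between t (drop-∷-⊆ P⊆Q) P≤t t≤Q
... | R , P⊆R , R⊆Q , refl = outside ∷ R , out⊆ P⊆R , out⊆ R⊆Q , refl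
between {P = outside ∷ P} {inside ∷ Q} t P⊆Q P≤t t≤1+Q with t ≤? ∣ Q ∣
... | no t≰Q = inside ∷ Q , out⊆ (drop-∷-⊆ P⊆Q) , id , ≤-antisym (≰⇒> t≰Q) t≤1+Q
... | yes t≤Q with between t (drop-∷-⊆ P⊆Q) P≤t t≤Q
...   | R , P⊆R , R⊆Q , refl = outside ∷ R , out⊆ P⊆R , out⊆ R⊆Q , refl

-- The sets H(C) at a vertex

module Spokes {n : ℕ} (v0 : Fin n) where

  N : Subset n
  N = ∁ ⁅ v0 ⁆

  F : ESet n
  F = K N

  H : Subset n → ESet n
  H C e = K (⁅ v0 ⁆ ∪ C) e ∨ K N e

  ∈N⇒≢ : {w : Fin n} → w ∈ N → w ≢ v0
  ∈N⇒≢ w∈N refl = x∈p⇒x∉∁p (x∈⁅x⁆ v0) w∈N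

  ≢⇒∈N : {w : Fin n} → w ≢ v0 → w ∈ N
  ≢⇒∈N w≢v0 = x∉p⇒x∈∁p (x≢y⇒x∉⁅y⁆ w≢v0)

  spoke : (w : Fin n) → .(w ≢ v0) → Edge n
  spoke w w≢v0 with FP.<-cmp v0 w
  ... | tri< v0<w _ _ = v0 , w , v0<w
  ... | tri≈ _ v0≡w _ = ⊥-elim-irr (w≢v0 (sym v0≡w))
  ... | tri> _ _ w<v0 = w , v0 , w<v0

  K-spoke : (W : Subset n) (w : Fin n) .(w≢v0 : w ≢ v0) →
            K W (spoke w w≢v0) ≡ lookup W v0 ∧ lookup W w
  K-spoke W w w≢v0 with FP.<-cmp v0 w
  ... | tri< _ _ _    = refl
  ... | tri≈ _ v0≡w _ = ⊥-elim-irr (w≢v0 (sym v0≡w))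
  ... | tri> _ _ _    = ∧-comm (lookup W w) (lookup W v0)

  spoke-from-v0 : {w : Fin n} (v0<w : v0 <ᶠ w) → (v0 , w , v0<w) ≡ spoke w (FP.<⇒≢ v0<w ∘ sym)
  spoke-from-v0 {w} v0<w with FP.<-cmp v0 w
  ... | tri< v0<w' _ _ = edge-≡ v0<w v0<w' refl refl
  ... | tri≈ v0≮w _ _ = contradiction v0<w v0≮w
  ... | tri> v0≮w _ _ = contradiction v0<w v0≮w

  spoke-to-v0 : {w : Fin n} (w<v0 : w <ᶠ v0) → (w , v0 , w<v0) ≡ spoke w (FP.<⇒≢ w<v0)
  spoke-to-v0 {w} w<v0 with FP.<-cmp v0 w
  ... | tri< _ _ w≮v0 = contradiction w<v0 w≮v0
  ... | tri≈ _ _ w≮v0 = contradiction w<v0 w≮v0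
  ... | tri> _ _ w<v0' = edge-≡ w<v0 w<v0' refl refl

  ∉F⇒spoke : (e : Edge n) → F e ≡ false → ∃ λ w → ∃ λ (w≢v0 : w ≢ v0) → e ≡ spoke w w≢v0
  ∉F⇒spoke (u , v , u<v) Fe with u F.≟ v0 | v F.≟ v0
  ... | yes refl | _        = v , FP.<⇒≢ u<v ∘ sym , spoke-from-v0 u<v
  ... | no _     | yes refl = u , FP.<⇒≢ u<v , spoke-to-v0 u<v
  ... | no u≢v0  | no v≢v0  =
    true≢false (∧-≡-true ([]=⇒lookup (≢⇒∈N u≢v0)) ([]=⇒lookup (≢⇒∈N v≢v0))) Fe

  spoke-∈-H : {C : Subset n} {w : Fin n} .(w≢v0 : w ≢ v0) → w ∈ C → H C (spoke w w≢v0) ≡ true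
  spoke-∈-H {C} {w} w≢v0 w∈C = ∨-≡-trueˡ _ (trans (K-spoke (⁅ v0 ⁆ ∪ C) w w≢v0)
    (∧-≡-true ([]=⇒lookup (p⊆p∪q C (x∈⁅x⁆ v0))) ([]=⇒lookup (q⊆p∪q ⁅ v0 ⁆ C w∈C))))

  spoke-∉-H : {C : Subset n} {w : Fin n} (w≢v0 : w ≢ v0) → w ∉ C → H C (spoke w w≢v0) ≡ false
  spoke-∉-H {C} {w} w≢v0 w∉C = cong₂ _∨_
    (trans (K-spoke (⁅ v0 ⁆ ∪ C) w w≢v0)
      (trans (cong (lookup (⁅ v0 ⁆ ∪ C) v0 ∧_)
                   (∉⇒lookup (Sum.[ x≢y⇒x∉⁅y⁆ w≢v0 , w∉C ] ∘ x∈p∪q⁻ ⁅ v0 ⁆ C)))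
             (∧-zeroʳ _)))
    (trans (K-spoke N w w≢v0) (cong (_∧ lookup N w) (∉⇒lookup (λ v0∈N → ∈N⇒≢ v0∈N refl))))

  K-mono : {W W' : Subset n} → W ⊆ W' → K W ⊆E K W'
  K-mono {W} {W'} W⊆W' (u , v , _) Ke =
    ∧-≡-true (lookup-mono u (∧-conicalˡ _ _ Ke)) (lookup-mono v (∧-conicalʳ _ _ Ke))
    where
    lookup-mono : ∀ x → lookup W x ≡ true → lookup W' x ≡ true
    lookup-mono x Wx = []=⇒lookup (W⊆W' (lookup⇒[]= x W Wx))

  H-mono : {C D : Subset n} → C ⊆ D → H C ⊆E H D
  H-mono {C} {D} C⊆D e He with K (⁅ v0 ⁆ ∪ C) e in KC
  ... | true  = ∨-≡-trueˡ _ (K-mono (x∈p∪q⁺ ∘ Sum.map₂ C⊆D ∘ x∈p∪q⁻ ⁅ v0 ⁆ C) e KC)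
  ... | false = ∨-≡-trueʳ _ He

  F⊆H : (C : Subset n) → F ⊆E H C
  F⊆H C e = ∨-≡-trueʳ (K (⁅ v0 ⁆ ∪ C) e)

  H∖F⇒spoke : {C : Subset n} (e : Edge n) → H C e ≡ true → F e ≡ false →
              ∃ λ w → ∃ λ (w≢v0 : w ≢ v0) → w ∈ C × e ≡ spoke w w≢v0
  H∖F⇒spoke {C} e He Fe with ∉F⇒spoke e Fe
  ... | w , w≢v0 , refl with w ∈? C
  ...   | yes w∈C = w , w≢v0 , w∈C , refl
  ...   | no  w∉C = true≢false He (spoke-∉-H w≢v0 w∉C)

  H-⊆-insert-spoke : {C : Subset n} {c : Fin n} (c≢v0 : c ≢ v0) →
                     H C ⊆E insert (spoke c c≢v0) (H (C - c))
  H-⊆-insert-spoke {C} {c} c≢v0 e He with true⊎false (F e)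
  ... | inj₁ Fe = ⊆E-insert (spoke c c≢v0) (H (C - c)) e (F⊆H (C - c) e Fe)
  ... | inj₂ Fe with H∖F⇒spoke e He Fe
  ...   | w , w≢v0 , w∈C , refl with w F.≟ c
  ...     | yes refl = insert-∋ (spoke c c≢v0) (H (C - c))
  ...     | no w≢c   =
    ⊆E-insert (spoke c c≢v0) (H (C - c)) (spoke w w≢v0) (spoke-∈-H w≢v0 (x∈p∧x≢y⇒x∈p-y w∈C w≢c))

  insert-spoke-⊆-H : {C : Subset n} {c : Fin n} .(c≢v0 : c ≢ v0) → c ∈ C →
                     insert (spoke c c≢v0) (H (C - c)) ⊆E H C
  insert-spoke-⊆-H {C} {c} c≢v0 c∈C =
    insert-⊆E (spoke c c≢v0) (H-mono (p─q⊆p C ⁅ c ⁆)) (spoke-∈-H c≢v0 c∈C)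

  card-⊆-H : (t : ℕ) {C : Subset n} → C ⊆ N → ∣ C ∣ ≡ t → {X : ESet n} → X ⊆E H C →
             card X ≤ card (X ∩E F) + t
  card-⊆-H zero {C} _ ∣C∣≡0 {X} X⊆HC = ≤-trans (card-mono X⊆X∩F) (m≤m+n _ 0)
    where
    X⊆X∩F : X ⊆E (X ∩E F)
    X⊆X∩F e Xe with true⊎false (F e)
    ... | inj₁ Fe = ∧-≡-true Xe Fe
    ... | inj₂ Fe with H∖F⇒spoke e (X⊆HC e Xe) Fe
    ...   | _ , _ , w∈C , _ = contradiction (subst (0 <_) ∣C∣≡0 (x∈p⇒0<∣p∣ w∈C)) λ ()
  card-⊆-H (suc t) {C} C⊆N ∣C∣≡ {X} X⊆HC with 0<∣p∣⇒Nonempty (subst (0 <_) (sym ∣C∣≡) z<s)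
  ... | c , c∈C = begin
    card X                                ≤⟨ card-⊆E-insert s (⊆E-insert-∩E s X⊆) ⟩
    suc (card (X ∩E H C'))                ≤⟨ s≤s (card-⊆-H t C'⊆N ∣C'∣ (∩E-⊆ʳ X (H C'))) ⟩
    suc (card ((X ∩E H C') ∩E F) + t)     ≤⟨ s≤s (+-monoˡ-≤ t (card-mono shrink)) ⟩
    suc (card (X ∩E F) + t)               ≡⟨ +-suc _ t ⟨
    card (X ∩E F) + suc t                 ∎
    where
    open ≤-Reasoning
    C' = C - c
    c≢v0 = ∈N⇒≢ (C⊆N c∈C)
    s = spoke c c≢v0
    X⊆ : X ⊆E insert s (H C')
    X⊆ e Xe = H-⊆-insert-spoke c≢v0 e (X⊆HC e Xe)
    C'⊆N : C' ⊆ N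
    C'⊆N = C⊆N ∘ p─q⊆p C ⁅ c ⁆
    ∣C'∣ : ∣ C' ∣ ≡ t
    ∣C'∣ = suc-injective (trans (∣p-x∣ c∈C) ∣C∣≡)
    shrink : ((X ∩E H C') ∩E F) ⊆E (X ∩E F)
    shrink e h = ∧-≡-true (∩E-⊆ˡ X (H C') e (∩E-⊆ˡ (X ∩E H C') F e h)) (∩E-⊆ʳ (X ∩E H C') F e h)

-- Ranks of H(A) and of K(V - v0)

K-⊤ : ∀ {n} (e : Edge n) → K ⊤ e ≡ true
K-⊤ (u , v , _) = ∧-≡-true (lookup-replicate u true) (lookup-replicate v true)

module RankOfH {n : ℕ} (M : Matroid n) (v0 : Fin n) {d : ℕ} (2+d≤n : 2 + d ≤ n) where
  open Matroid M
  open Rank M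
  open Spokes v0
  open RawMonad (¬¬-Monad {a = 0ℓ})

  ∣N∣ : ∣ N ∣ ≡ n ∸ 1
  ∣N∣ = trans (∣∁p∣≡n∸∣p∣ ⁅ v0 ⁆) (cong (n ∸_) (∣⁅x⁆∣≡1 v0))

  N-nonempty : Nonempty N
  N-nonempty = 0<∣p∣⇒Nonempty (≤-trans (s≤s z≤n) (subst (suc d ≤_) (sym ∣N∣) (∸-monoˡ-≤ 1 2+d≤n)))

  d≤∣N-c∣ : {c : Fin n} → c ∈ N → d ≤ ∣ N - c ∣
  d≤∣N-c∣ c∈N = ≤-pred (subst (suc d ≤_) (sym (trans (∣p-x∣ c∈N) ∣N∣)) (∸-monoˡ-≤ 1 2+d≤n))

  enlarge : {c : Fin n} {C : Subset n} → c ∈ N → C ⊆ N - c → ∣ C ∣ ≤ d →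
            ∃ λ A → C ⊆ A × A ⊆ N × ∣ A ∣ ≡ d × c ∉ A
  enlarge {c} c∈N C⊆ ∣C∣≤d with between d C⊆ ∣C∣≤d (d≤∣N-c∣ c∈N)
  ... | A , C⊆A , A⊆N-c , ∣A∣ = A , C⊆A , p─q⊆p N ⁅ c ⁆ ∘ A⊆N-c , ∣A∣ , x∉p-x N ∘ A⊆N-c

  avoiding : {c : Fin n} → c ∈ N → ∃ λ A → A ⊆ N × ∣ A ∣ ≡ d × c ∉ A
  avoiding c∈N with enlarge c∈N ⊥⊆ (subst (_≤ d) (sym (∣⊥∣≡0 n)) z≤n)
  ... | A , _ , A⊆N , ∣A∣ , c∉A = A , A⊆N , ∣A∣ , c∉A

  AllFlat : Set
  AllFlat = ∀ A → A ⊆ N → ∣ A ∣ ≡ d → Flat (H A)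

  H-rank-upper : {ρ : ℕ} → RankAtMost F ρ → {C : Subset n} → C ⊆ N → RankAtMost (H C) (ρ + ∣ C ∣)
  H-rank-upper boundF C⊆N I indI I⊆HC =
    ≤-trans (card-⊆-H _ C⊆N refl I⊆HC) (+-monoˡ-≤ _ (boundF _ (indep-⊆ (∩E-⊆ˡ I F) indI) (∩E-⊆ʳ I F)))

  spoke-∉-closure : AllFlat → {c : Fin n} {C : Subset n} (c∈N : c ∈ N) → C ⊆ N - c → ∣ C ∣ ≤ d →
                    ¬ InClosure M (H C) (spoke c (∈N⇒≢ c∈N))
  spoke-∉-closure flat c∈N C⊆ ∣C∣≤d span with enlarge c∈N C⊆ ∣C∣≤d
  ... | A , C⊆A , A⊆N , ∣A∣ , c∉A = ¬¬-HasRank (H A) λ (_ , hA) →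
    flat A A⊆N ∣A∣ s (spoke-∉-H (∈N⇒≢ c∈N) c∉A) (InClosure-mono {x = s} (H-mono C⊆A) span hA)
    where s = spoke _ (∈N⇒≢ c∈N)

  H-rank-lower : AllFlat → {ρ : ℕ} → HasRank M F ρ → (t : ℕ) {C : Subset n} {q : ℕ} →
                 C ⊆ N → ∣ C ∣ ≡ t → t ≤ d → HasRank M (H C) q → ρ + t ≤ q
  H-rank-lower _ hF zero _ _ _ hC =
    subst (_≤ _) (sym (+-identityʳ _)) (HasRank-mono (F⊆H _) hF (proj₂ hC))
  H-rank-lower flat {ρ} hF (suc t) {C} {q} C⊆N ∣C∣≡ t<d hC
    with 0<∣p∣⇒Nonempty (subst (0 <_) (sym ∣C∣≡) z<s)
  ... | c , c∈C = decidable-stable (ρ + suc t ≤? q) do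
    q' , hC' ← ¬¬-HasRank (H C')
    pure (begin
      ρ + suc t   ≡⟨ +-suc ρ t ⟩
      suc (ρ + t) ≤⟨ s≤s (H-rank-lower flat hF t C'⊆N ∣C'∣ (<⇒≤ t<d) hC') ⟩
      suc q'      ≤⟨ rank-grows {x = spoke c c≢v0} hC' (spoke-∉-H c≢v0 (x∉p-x C))
                      (spoke-∉-closure flat c∈N (p⊆q⇒p-x⊆q-x C⊆N)
                                       (≤-trans (≤-reflexive ∣C'∣) (<⇒≤ t<d)))
                      (insert-spoke-⊆-H c≢v0 c∈C) (proj₂ hC) ⟩
      q           ∎)
    where
    open ≤-Reasoning
    C' = C - c
    c∈N = C⊆N c∈C
    c≢v0 = ∈N⇒≢ c∈N
    C'⊆N : C' ⊆ N
    C'⊆N = C⊆N ∘ p─q⊆p C ⁅ c ⁆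
    ∣C'∣ : ∣ C' ∣ ≡ t
    ∣C'∣ = suc-injective (trans (∣p-x∣ c∈C) ∣C∣≡)

  H-rank : AllFlat → {ρ q : ℕ} → HasRank M F ρ → {A : Subset n} → A ⊆ N → ∣ A ∣ ≡ d →
           HasRank M (H A) q → q ≡ ρ + d
  H-rank flat {ρ} hF A⊆N ∣A∣ hA@((I , indI , I⊆HA , refl) , _) =
    ≤-antisym (subst (λ k → card I ≤ ρ + k) ∣A∣ (H-rank-upper (proj₂ hF) A⊆N I indI I⊆HA))
              (H-rank-lower flat hF _ A⊆N ∣A∣ ≤-refl hA)

  ∃-HasRank-F : AllFlat → {A : Subset n} {q : ℕ} → A ⊆ N → ∣ A ∣ ≡ d → HasRank M (H A) q →
                ∃ (HasRank M F)
  ∃-HasRank-F flat A⊆N ∣A∣ hA@((I , indI , I⊆HA , refl) , _) =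
    card (I ∩E F) , (I ∩E F , indep-⊆ (∩E-⊆ˡ I F) indI , ∩E-⊆ʳ I F , refl) , boundF
    where
    boundF : RankAtMost F (card (I ∩E F))
    boundF L indL L⊆F = decidable-stable (_ ≤? _) do
      ρ , hF ← ¬¬-HasRank F
      pure (≤-trans (proj₂ hF L indL L⊆F) (+-cancelʳ-≤ d ρ _ (begin
        ρ + d             ≡⟨ H-rank flat hF A⊆N ∣A∣ hA ⟨
        card I            ≤⟨ card-⊆-H d A⊆N ∣A∣ I⊆HA ⟩
        card (I ∩E F) + d ∎)))
      where open ≤-Reasoning

  F-closed : (∀ A → A ⊆ N → ∣ A ∣ ≡ d → Closed M (H A)) → Closed M F
  F-closed closed e = F⊆cl , cl⊆F
    where
    flat : AllFlat
    flat A A⊆N ∣A∣ = Closed⇒Flat (closed A A⊆N ∣A∣)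

    F⊆cl : F e ≡ true → InClosure M F e
    F⊆cl Fe with avoiding (proj₂ N-nonempty)
    ... | A , A⊆N , ∣A∣ , _ with proj₁ (closed A A⊆N ∣A∣ e) (F⊆H A e Fe)
    ...   | _ , hA , _ = InClosure-∈ {X = F} {e} Fe (proj₂ (∃-HasRank-F flat A⊆N ∣A∣ hA))

    cl⊆F : InClosure M F e → F e ≡ true
    cl⊆F span with true⊎false (F e)
    ... | inj₁ Fe = Fe
    ... | inj₂ Fe with ∉F⇒spoke e Fe
    ...   | w , w≢v0 , e≡spoke with avoiding (≢⇒∈N w≢v0)
    ...     | A , A⊆N , ∣A∣ , w∉A = ⊥-elim (¬¬-HasRank (H A) λ (_ , hA) →
      flat A A⊆N ∣A∣ e (subst (λ f → H A f ≡ false) (sym e≡spoke) (spoke-∉-H w≢v0 w∉A))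
        (InClosure-mono {x = e} (F⊆H A) span hA))

  F-rank : (∀ A → A ⊆ N → ∣ A ∣ ≡ d → IsHyperplane M (H A)) →
                          {k j : ℕ} → HasRank M (K ⊤) k → HasRank M F j → j + suc d ≡ k
  F-rank hyperplane {k} {j} hE hF with N-nonempty
  ... | w , w∈N with avoiding w∈N
  ...   | A , A⊆N , ∣A∣ , w∉A = decidable-stable (j + suc d ≟ k) do
    q , hA ← ¬¬-HasRank (H A)
    pure (begin
      j + suc d   ≡⟨ +-suc j d ⟩
      suc (j + d) ≡⟨ cong suc (H-rank flat hF A⊆N ∣A∣ hA) ⟨
      suc q       ≡⟨ hyperplane-rank {x = spoke w (∈N⇒≢ w∈N)} (hyperplane A A⊆N ∣A∣)
                                     (spoke-∉-H (∈N⇒≢ w∈N) w∉A) K-⊤ hE hA ⟩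
      k           ∎)
    where
    open ≡-Reasoning
    flat : AllFlat
    flat A A⊆N ∣A∣ = IsHyperplane⇒Flat (hyperplane A A⊆N ∣A∣)

mainTheorem11 : (m n : ℕ) → 2 ≤ m → m + 1 ≤ n → (M : Matroid n) → (v₀ : Fin n) →
    ((∀ (v : Fin n) (A : Subset n) → A ⊆ ∁ ⁅ v ⁆ → ∣ A ∣ ≡ m ∸ 1 →
        Closed M (λ e → K (⁅ v ⁆ ∪ A) e ∨ K (∁ ⁅ v ⁆) e))
      → Closed M (K (∁ ⁅ v₀ ⁆)))
    ×
    ((∀ (v : Fin n) (A : Subset n) → A ⊆ ∁ ⁅ v ⁆ → ∣ A ∣ ≡ m ∸ 1 →
        IsHyperplane M (λ e → K (⁅ v ⁆ ∪ A) e ∨ K (∁ ⁅ v ⁆) e))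
      → ∀ (k j : ℕ) → HasRank M (K ⊤) k → HasRank M (K (∁ ⁅ v₀ ⁆)) j → j + m ≡ k)
-- The hypothesis 2 ≤ m is only used to write m = suc d.
mainTheorem11 (suc d) n _ m+1≤n M v₀ =
  (λ closed → F-closed (closed v₀)) ,
  (λ hyperplanes k j → F-rank (hyperplanes v₀))
  where open RankOfH M v₀ (subst (_≤ n) (+-comm (suc d) 1) m+1≤n)
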